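{- Let $Q$ be an ice quiver whose mutable subquiver is an abundant acyclic quiver. Suppose that for every mutable vertex $v$, the ice quiver $\mu_v(Q)$ satisfies (all vertices below being mutable): (a) every mutable vertex of $\mu_v(Q)$ is red or green; (b) if $b^{[v]}_{vj}c^{[v]}_j\ge0$ for some $j\ne v$, then $\mathrm{sgn}(c^{[v]}_j)=\mathrm{sgn}(c^{[v]}_v)$ or $\mathrm{sgn}(c^{[v]}_j)c^{[v]}_j\ge\mathrm{sgn}(c^{[v]}_v)c^{[v]}_v$; (c) if $b^{[v]}_{vj}c^{[v]}_j\le0$ for some $j\ne v$, then $\mathrm{sgn}(c^{[v]}_j)=-\mathrm{sgn}(c^{[v]}_v)$; (d) if $b^{[v]}_{ij}c^{[v]}_j\ge0$ for distinct $i,j$ both different from $v$, then $\mathrm{sgn}(c^{[v]}_i)=\mathrm{sgn}(c^{[v]}_j)$. Then $Q$ is strictly sign-coherent. In particular, the framing and the coframing of any abundant acyclic quiver are strictly sign-coherent.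
   Context: Quivers have no loops or 2-cycles. An ice quiver has mutable vertices $1,\dots,n$ and frozen vertices $n+1,\dots,n+m$; mutation (only at mutable vertices) at $k$: add an arrow $a\to b$ for each path $a\to k\to b$, reverse arrows at $k$, delete 2-cycles. Its extended exchange matrix is $[B\mid C]$ with $b_{ij}=$ (number of arrows $i\to j$ minus number of arrows $j\to i$) for mutable $i,j$, and $C$ given by the same rule for mutable $i$ and frozen $j$; superscript $[v]$ denotes the matrices of $\mu_v(Q)$, and $c^{[v]}_i$ is the $i$-th row of $C^{[v]}$. A mutable vertex $i$ is green iff $c_i$ is nonzero with entries $\ge0$ ($\mathrm{sgn}(c_i)=1$), red iff nonzero with entries $\le0$ ($\mathrm{sgn}(c_i)=-1$). Vector inequalities are componentwise. An ice quiver is strictly sign-coherent if every ice quiver obtained from it by a sequence of mutations has every mutable vertex red or green. Abundant: at least two arrows between every pair of distinct vertices; acyclic: no directed cycle. The framing of a quiver $Q$ adds for each vertex $i$ a frozen vertex $i'$ with one arrow $i\to i'$; the coframing adds a frozen $i'$ with one arrow $i'\to i$. -}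

module Defs where

open import Data.Nat as ℕ using (ℕ; _∸_)
open import Data.Integer as ℤ using (ℤ; +_; -_; _-_; _*_; _≤_; 0ℤ; 1ℤ; -1ℤ)
open import Data.Fin using (Fin; _↑ˡ_; _↑ʳ_; splitAt)
open import Data.Fin.Properties using (all?; any?)
open import Data.Sum using (_⊎_; inj₁; inj₂)
open import Data.Product using (_×_; ∃)
open import Data.List using (List; []; _∷_)
open import Data.Bool using (if_then_else_)
open import Relation.Nullary using (¬_; does)
open import Relation.Nullary.Decidable using (_×-dec_; ¬?)
open import Relation.Binary.PropositionalEquality using (_≡_; _≢_)

-- A (raw) quiver on N vertices: number of arrows i → j.
Quiver : ℕ → Set
Quiver N = Fin N → Fin N → ℕ

IsQuiver : ∀ {N} → Quiver N → Set
IsQuiver {N} Q = (∀ i → Q i i ≡ 0) × (∀ i j → Q i j ≡ 0 ⊎ Q j i ≡ 0)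

-- Ice quiver with n mutable vertices (inject+ m i) and m frozen ones (raise n j).
record IceQuiver (n m : ℕ) : Set where
  constructor ice
  field arr : Quiver (n ℕ.+ m)
open IceQuiver public

mut : ∀ {n} m → Fin n → Fin (n ℕ.+ m)
mut m i = i ↑ˡ m

frz : ∀ n {m} → Fin m → Fin (n ℕ.+ m)
frz n j = n ↑ʳ j

-- Quiver mutation at vertex k (for a quiver without loops / 2-cycles):
-- arrows at k are reversed; for a, b ≠ k, add Q a k * Q k b arrows a → b
-- (one for each path a → k → b), then delete 2-cycles.
mutateQ : ∀ {N} → Fin N → Quiver N → Quiver N
mutateQ {N} k Q a b with does (a Data.Fin.≟ k) | does (b Data.Fin.≟ k)
... | Data.Bool.true  | _ = Q b a
... | Data.Bool.false | Data.Bool.true = Q b a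
... | Data.Bool.false | Data.Bool.false = t a b ∸ t b a
  where
  t : Fin N → Fin N → ℕ
  t x y = Q x y ℕ.+ Q x k ℕ.* Q k y

μ : ∀ {n m} → Fin n → IceQuiver n m → IceQuiver n m
μ {m = m} k Q = ice (mutateQ (mut m k) (arr Q))

μs : ∀ {n m} → List (Fin n) → IceQuiver n m → IceQuiver n m
μs []       Q = Q
μs (k ∷ ks) Q = μs ks (μ k Q)

Bmat : ∀ {n m} → IceQuiver n m → Fin n → Fin n → ℤ
Bmat {m = m} Q i j = + arr Q (mut m i) (mut m j) - + arr Q (mut m j) (mut m i)

Cmat : ∀ {n m} → IceQuiver n m → Fin n → Fin m → ℤ
Cmat {n} {m} Q i j = + arr Q (mut m i) (frz n j) - + arr Q (frz n j) (mut m i)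

Green : ∀ {m} → (Fin m → ℤ) → Set
Green c = (∀ k → 0ℤ ≤ c k) × (¬ (∀ k → c k ≡ 0ℤ))

Red : ∀ {m} → (Fin m → ℤ) → Set
Red c = (∀ k → c k ≤ 0ℤ) × (¬ (∀ k → c k ≡ 0ℤ))

RedOrGreen : ∀ {m} → (Fin m → ℤ) → Set
RedOrGreen c = Red c ⊎ Green c

sgn : ∀ {m} → (Fin m → ℤ) → ℤ
sgn c =
  if does (all? (λ k → 0ℤ ℤ.≤? c k) ×-dec ¬? (all? (λ k → c k ℤ.≟ 0ℤ)))
  then 1ℤ
  else (if does (all? (λ k → c k ℤ.≤? 0ℤ) ×-dec ¬? (all? (λ k → c k ℤ.≟ 0ℤ)))
        then -1ℤ else 0ℤ)

_≤v_ : ∀ {m} → (Fin m → ℤ) → (Fin m → ℤ) → Set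
u ≤v w = ∀ k → u k ≤ w k

0v : ∀ {m} → Fin m → ℤ
0v _ = 0ℤ

_·_ : ∀ {m} → ℤ → (Fin m → ℤ) → (Fin m → ℤ)
(s · c) k = s * c k

StrictlySignCoherent : ∀ {n m} → IceQuiver n m → Set
StrictlySignCoherent Q =
  ∀ ks i → RedOrGreen (Cmat (μs ks Q) i)

data Path {N} (Q : Quiver N) : Fin N → Fin N → Set where
  edge : ∀ {a b} → ¬ (Q a b ≡ 0) → Path Q a b
  step : ∀ {a b c} → ¬ (Q a b ≡ 0) → Path Q b c → Path Q a c

Acyclic : ∀ {N} → Quiver N → Set
Acyclic Q = ∀ a → ¬ Path Q a a

Abundant : ∀ {N} → Quiver N → Set
Abundant Q = ∀ a b → a ≢ b → 2 ℕ.≤ Q a b ℕ.+ Q b a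

mutablePart : ∀ {n m} → IceQuiver n m → Quiver n
mutablePart {m = m} Q i j = arr Q (mut m i) (mut m j)

framing : ∀ {n} → Quiver n → IceQuiver n n
framing {n} Q = ice arrows
  where
  arrows : Quiver (n ℕ.+ n)
  arrows a b with splitAt n a | splitAt n b
  ... | inj₁ i | inj₁ j = Q i j
  ... | inj₁ i | inj₂ j = if does (i Data.Fin.≟ j) then 1 else 0
  ... | inj₂ _ | _      = 0

coframing : ∀ {n} → Quiver n → IceQuiver n n
coframing {n} Q = ice arrows
  where
  arrows : Quiver (n ℕ.+ n)
  arrows a b with splitAt n a | splitAt n b
  ... | inj₁ i | inj₁ j = Q i j
  ... | inj₂ i | inj₁ j = if does (i Data.Fin.≟ j) then 1 else 0
  ... | _      | inj₂ _ = 0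

module _ {n m : ℕ} (Q : IceQuiver n m) (v : Fin n) where
  private
    B = Bmat (μ v Q)
    c = Cmat (μ v Q)

  CondA : Set
  CondA = ∀ i → RedOrGreen (c i)

  CondB : Set
  CondB = ∀ j → j ≢ v → 0v ≤v (B v j · c j) →
            sgn (c j) ≡ sgn (c v) ⊎ ((sgn (c v) · c v) ≤v (sgn (c j) · c j))

  CondC : Set
  CondC = ∀ j → j ≢ v → (B v j · c j) ≤v 0v → sgn (c j) ≡ - sgn (c v)

  CondD : Set
  CondD = ∀ i j → i ≢ j → i ≢ v → j ≢ v → 0v ≤v (B i j · c j) →
            sgn (c i) ≡ sgn (c j)

-- Colour each mutable vertex by the sign of its c-vector (true = green, false = red) and orient
-- arrows by colours. Mutating an abundant acyclic quiver at v gives a fork with point of return v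
-- (Warkentin), and mutating a fork at any u other than its point of return gives a fork with point
-- of return u. Hypotheses (a)–(d) say that μ_v(Q) carries a colouring compatible with its arrows:
-- arrows between differently coloured vertices other than v run in the direction of the colour of
-- the source, v is joined in the direction of its colour to every vertex of its colour, and
-- |c_v| ≤ |c_j| whenever j has the other colour and v is joined to j in the direction of j's colour.
-- Mutation at u adds to c_j a multiple of c_u, by the number of suitably oriented arrows between
-- j and u, so abundance (at least two arrows) and this compatibility determine every new sign: u
-- changes colour, v takes the colour of u when it is joined to u in that colour, all others keep
-- theirs; and the new colouring is compatible with the fork μ_u μ_v(Q). Since mutation is
-- involutive, every mutation sequence reduces to one without immediate repetitions, that is, to a
-- chain of such steps. For the framing (coframing) all rows are green (red), which is trivially
-- compatible.
module Submission where

open import Defs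
open import Data.Nat as ℕ using (ℕ; zero; suc; _+_; _*_; _∸_; _≤_; _<_; z≤n; s≤s)
open import Data.Nat.Properties
open import Data.Fin as F using (Fin; splitAt)
open import Data.Fin.Properties using (↑ˡ-injective; splitAt-↑ˡ; splitAt-↑ʳ; all?)
open import Data.Sum as Sum using (_⊎_; inj₁; inj₂; [_,_]′)
open import Data.Product as Prod using (_×_; _,_; proj₁; proj₂; Σ; ∃)
open import Data.Bool using (Bool; true; false; not)
import Data.Bool.Properties as BP
open import Data.Empty using (⊥; ⊥-elim)
open import Data.Maybe using (Maybe; just; nothing)
open import Data.List using ([]; _∷_)
open import Data.Unit using (⊤; tt)
open import Function using (_∘_; const; id)
open import Relation.Nullary using (¬_; yes; no; Dec)
open import Relation.Nullary.Decidable using (_×-dec_; ¬?; toSum; dec-true; dec-false)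
open import Relation.Binary.PropositionalEquality

m∸n≡0⊎n∸m≡0 : ∀ m n → m ∸ n ≡ 0 ⊎ n ∸ m ≡ 0
m∸n≡0⊎n∸m≡0 m n = Sum.map m≤n⇒m∸n≡0 m≤n⇒m∸n≡0 (≤-total m n)

m≡0⊎n≡0⇒m∸n≡m : ∀ {m n} → m ≡ 0 ⊎ n ≡ 0 → m ∸ n ≡ m
m≡0⊎n≡0⇒m∸n≡m {n = n} (inj₁ refl) = 0∸n≡0 n
m≡0⊎n≡0⇒m∸n≡m         (inj₂ refl) = refl

m≡0⊎n≡0⇒n∸m≡n : ∀ {m n} → m ≡ 0 ⊎ n ≡ 0 → n ∸ m ≡ n
m≡0⊎n≡0⇒n∸m≡n = m≡0⊎n≡0⇒m∸n≡m ∘ Sum.swap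

m∸n+n≡n∸m+m : ∀ m n → (m ∸ n) + n ≡ (n ∸ m) + m
m∸n+n≡n∸m+m zero    n       = trans (cong (_+ n) (0∸n≡0 n)) (sym (+-identityʳ n))
m∸n+n≡n∸m+m (suc m) zero    = +-comm (suc m) 0
m∸n+n≡n∸m+m (suc m) (suc n) =
  trans (+-suc (m ∸ n) n) (trans (cong suc (m∸n+n≡n∸m+m m n)) (sym (+-suc (n ∸ m) m)))

m+o≤n⇒m≤n∸o : ∀ m {n o} → m + o ≤ n → m ≤ n ∸ o
m+o≤n⇒m≤n∸o m {o = o} m+o≤n = ≤-trans (≤-reflexive (sym (m+n∸n≡m m o))) (∸-monoˡ-≤ o m+o≤n)

n+n≤m*n : ∀ {m} n → 2 ≤ m → n + n ≤ m * n
n+n≤m*n n 2≤m = ≤-trans (≤-reflexive (cong (n +_) (sym (+-identityʳ n)))) (*-monoˡ-≤ n 2≤m)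

n<m*n∸o : ∀ {m n o} → 2 ≤ m → o < n → n < m * n ∸ o
n<m*n∸o {n = n} {o} 2≤m o<n = m+o≤n⇒m≤n∸o (suc n) (begin
  suc n + o ≡⟨ +-suc n o ⟨
  n + suc o ≤⟨ +-monoʳ-≤ n o<n ⟩
  n + n     ≤⟨ n+n≤m*n n 2≤m ⟩
  _         ∎)
  where open ≤-Reasoning

n≤m*n∸o : ∀ {m n o} → 2 ≤ m → o ≤ n → n ≤ m * n ∸ o
n≤m*n∸o {n = n} 2≤m o≤n = m+o≤n⇒m≤n∸o n (≤-trans (+-monoʳ-≤ n o≤n) (n+n≤m*n n 2≤m))

o∸m*n≡0 : ∀ {m n o} → 2 ≤ m → o ≤ n → o ∸ m * n ≡ 0
o∸m*n≡0 {n = n} 2≤m o≤n = m≤n⇒m∸n≡0 (≤-trans o≤n (≤-trans (m≤m+n n n) (n+n≤m*n n 2≤m)))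

m≤m*n′ : ∀ m {n} → 0 < n → m ≤ m * n
m≤m*n′ m 0<n = ≤-trans (≤-reflexive (sym (*-identityʳ m))) (*-monoʳ-≤ m 0<n)

n≤m*n′ : ∀ {m} n → 0 < m → n ≤ m * n
n≤m*n′ n 0<m = ≤-trans (≤-reflexive (sym (*-identityˡ n))) (*-monoˡ-≤ n 0<m)

¬[0<m×0<n]⇒m*n≡0 : ∀ {m n} → ¬ (0 < m × 0 < n) → m * n ≡ 0
¬[0<m×0<n]⇒m*n≡0 {zero}          _ = refl
¬[0<m×0<n]⇒m*n≡0 {suc m} {zero}  _ = *-zeroʳ (suc m)
¬[0<m×0<n]⇒m*n≡0 {suc m} {suc n} ¬0<m×0<n = ⊥-elim (¬0<m×0<n (s≤s z≤n , s≤s z≤n))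

0≮n⇒n≡0 : ∀ {n} → ¬ (0 < n) → n ≡ 0
0≮n⇒n≡0 0≮n = n≤0⇒n≡0 (≮⇒≥ 0≮n)

≢-not⇒≡ : ∀ {a b} → a ≢ not b → a ≡ b
≢-not⇒≡ {b = b} a≢¬b = trans (BP.¬-not a≢¬b) (BP.not-involutive b)

-- Splitting on this rather than `with`-abstracting `i F.≟ j` leaves alone the sign assignments
-- below, which are themselves defined by cases on such comparisons.
≡⊎≢ : ∀ {N} (i j : Fin N) → i ≡ j ⊎ i ≢ j
≡⊎≢ i j = toSum (i F.≟ j)

module _ {N} (k : Fin N) (Q : Quiver N) where

  mutateQ-reverseˡ : ∀ {a b} → a ≡ k → mutateQ k Q a b ≡ Q b a
  mutateQ-reverseˡ {a} a≡k with a F.≟ k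
  ... | yes _   = refl
  ... | no a≢k = ⊥-elim (a≢k a≡k)

  mutateQ-reverseʳ : ∀ {a b} → b ≡ k → mutateQ k Q a b ≡ Q b a
  mutateQ-reverseʳ {a} {b} b≡k with a F.≟ k | b F.≟ k
  ... | yes _ | _      = refl
  ... | no _  | yes _  = refl
  ... | no _  | no b≢k = ⊥-elim (b≢k b≡k)

  mutateQ-away : ∀ {a b} → a ≢ k → b ≢ k →
                 mutateQ k Q a b ≡ (Q a b + Q a k * Q k b) ∸ (Q b a + Q b k * Q k a)
  mutateQ-away {a} {b} a≢k b≢k with a F.≟ k | b F.≟ k
  ... | yes a≡k | _       = ⊥-elim (a≢k a≡k)
  ... | no _    | yes b≡k = ⊥-elim (b≢k b≡k)
  ... | no _    | no _    = refl

mutateQ-isQuiver : ∀ {N} (k : Fin N) (Q : Quiver N) → IsQuiver Q → IsQuiver (mutateQ k Q)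
mutateQ-isQuiver k Q (noLoop , no2Cycle) = noLoop′ , no2Cycle′
  where
  noLoop′ : ∀ i → mutateQ k Q i i ≡ 0
  noLoop′ i with i F.≟ k
  ... | yes _ = noLoop i
  ... | no _  = n∸n≡0 (Q i i + Q i k * Q k i)
  no2Cycle′ : ∀ i j → mutateQ k Q i j ≡ 0 ⊎ mutateQ k Q j i ≡ 0
  no2Cycle′ i j with i F.≟ k | j F.≟ k
  ... | yes _ | yes _ = Sum.swap (no2Cycle i j)
  ... | yes _ | no _  = Sum.swap (no2Cycle i j)
  ... | no _  | yes _ = Sum.swap (no2Cycle i j)
  ... | no _  | no _  = m∸n≡0⊎n∸m≡0 (Q i j + Q i k * Q k j) (Q j i + Q j k * Q k i)

mutateQ-cong : ∀ {N} (k : Fin N) {Q Q′ : Quiver N} → (∀ a b → Q a b ≡ Q′ a b) →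
               ∀ a b → mutateQ k Q a b ≡ mutateQ k Q′ a b
mutateQ-cong k {Q} {Q′} Q≗Q′ a b with a F.≟ k | b F.≟ k
... | yes _ | _     = Q≗Q′ b a
... | no _  | yes _ = Q≗Q′ b a
... | no _  | no _
  rewrite Q≗Q′ a b | Q≗Q′ b a | Q≗Q′ a k | Q≗Q′ k b | Q≗Q′ b k | Q≗Q′ k a = refl

-- Arrows a → b after mutating twice at k: x, y count the arrows a → b, b → a and p, r the paths
-- a → k → b, b → k → a; the first mutation reverses the paths through k, so the second adds r, p.
mutateQ²-count : ∀ x y p r → x ≡ 0 ⊎ y ≡ 0 →
                 (((x + p) ∸ (y + r)) + r) ∸ (((y + r) ∸ (x + p)) + p) ≡ x
mutateQ²-count x y p r (inj₂ refl) = begin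
  (((x + p) ∸ r) + r) ∸ ((r ∸ (x + p)) + p)
    ≡⟨ cong (_∸ ((r ∸ (x + p)) + p)) (m∸n+n≡n∸m+m (x + p) r) ⟩
  ((r ∸ (x + p)) + (x + p)) ∸ ((r ∸ (x + p)) + p)
    ≡⟨ [m+n]∸[m+o]≡n∸o (r ∸ (x + p)) (x + p) p ⟩
  (x + p) ∸ p
    ≡⟨ m+n∸n≡m x p ⟩
  x ∎
  where open ≡-Reasoning
mutateQ²-count x y p r (inj₁ refl) = m≤n⇒m∸n≡0 (begin
  (p ∸ (y + r)) + r        ≤⟨ +-monoʳ-≤ (p ∸ (y + r)) (m≤n+m r y) ⟩
  (p ∸ (y + r)) + (y + r)  ≡⟨ m∸n+n≡n∸m+m p (y + r) ⟩
  ((y + r) ∸ p) + p        ∎)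
  where open ≤-Reasoning

mutateQ-involutive : ∀ {N} (k : Fin N) (Q : Quiver N) → IsQuiver Q →
                     ∀ a b → mutateQ k (mutateQ k Q) a b ≡ Q a b
mutateQ-involutive k Q (_ , no2Cycle) a b with a F.≟ k | b F.≟ k
... | yes a≡k | _       rewrite mutateQ-reverseʳ k Q {b} {a} a≡k = refl
... | no _    | yes b≡k rewrite mutateQ-reverseˡ k Q {b} {a} b≡k = refl
... | no a≢k  | no b≢k
  rewrite mutateQ-reverseˡ k Q {k} {b} refl | mutateQ-reverseʳ k Q {a} {k} refl
        | mutateQ-reverseˡ k Q {k} {a} refl | mutateQ-reverseʳ k Q {b} {k} refl
        | mutateQ-away k Q a≢k b≢k | mutateQ-away k Q b≢k a≢k
        | *-comm (Q k a) (Q b k) | *-comm (Q k b) (Q a k) = mutateQ²-count _ _ _ _ (no2Cycle a b)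

module _ {n m : ℕ} where

  mut-injective : ∀ {i j : Fin n} → mut m i ≡ mut m j → i ≡ j
  mut-injective {i} {j} = ↑ˡ-injective m i j

  mut≢frz : ∀ (i : Fin n) (f : Fin m) → mut m i ≢ frz n f
  mut≢frz i f e with trans (sym (splitAt-↑ˡ n i m)) (trans (cong (splitAt n) e) (splitAt-↑ʳ n m f))
  ... | ()

  q : IceQuiver n m → Fin n → Fin n → ℕ
  q P = mutablePart P

  c⁺ c⁻ : IceQuiver n m → Fin n → Fin m → ℕ
  c⁺ P i f = arr P (mut m i) (frz n f)
  c⁻ P i f = arr P (frz n f) (mut m i)

  module _ (P : IceQuiver n m) (u : Fin n) where

    q-μ-from : ∀ j → q (μ u P) u j ≡ q P j u
    q-μ-from j = mutateQ-reverseˡ (mut m u) (arr P) refl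

    q-μ-to : ∀ j → q (μ u P) j u ≡ q P u j
    q-μ-to j = mutateQ-reverseʳ (mut m u) (arr P) refl

    q-μ-away : ∀ {a b} → a ≢ u → b ≢ u →
               q (μ u P) a b ≡ (q P a b + q P a u * q P u b) ∸ (q P b a + q P b u * q P u a)
    q-μ-away a≢u b≢u = mutateQ-away (mut m u) (arr P) (a≢u ∘ mut-injective) (b≢u ∘ mut-injective)

    c⁺-μ-self : ∀ f → c⁺ (μ u P) u f ≡ c⁻ P u f
    c⁺-μ-self f = mutateQ-reverseˡ (mut m u) (arr P) refl

    c⁻-μ-self : ∀ f → c⁻ (μ u P) u f ≡ c⁺ P u f
    c⁻-μ-self f = mutateQ-reverseʳ (mut m u) (arr P) refl

    c⁺-μ-away : ∀ {j} f → j ≢ u →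
                c⁺ (μ u P) j f ≡ (c⁺ P j f + q P j u * c⁺ P u f)
                               ∸ (c⁻ P j f + c⁻ P u f * q P u j)
    c⁺-μ-away f j≢u = mutateQ-away (mut m u) (arr P) (j≢u ∘ mut-injective) (mut≢frz u f ∘ sym)

    c⁻-μ-away : ∀ {j} f → j ≢ u →
                c⁻ (μ u P) j f ≡ (c⁻ P j f + c⁻ P u f * q P u j)
                               ∸ (c⁺ P j f + q P j u * c⁺ P u f)
    c⁻-μ-away f j≢u = mutateQ-away (mut m u) (arr P) (mut≢frz u f ∘ sym) (j≢u ∘ mut-injective)

  #Arrow : IceQuiver n m → Bool → Fin n → Fin n → ℕ
  #Arrow P true  i j = q P i j
  #Arrow P false i j = q P j i

  Arrow : IceQuiver n m → Bool → Fin n → Fin n → Set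
  Arrow P β i j = 0 < #Arrow P β i j

  Arrow? : ∀ P β i j → Dec (Arrow P β i j)
  Arrow? P β i j = 0 ℕ.<? #Arrow P β i j

  Arrow-flip : ∀ {P} β {i j} → Arrow P β i j → Arrow P (not β) j i
  Arrow-flip true  h = h
  Arrow-flip false h = h

  Arrow-unflip : ∀ {P} β {i j} → Arrow P (not β) i j → Arrow P β j i
  Arrow-unflip true  h = h
  Arrow-unflip false h = h

  #Arrow-μ-from : ∀ P u β j → #Arrow (μ u P) β u j ≡ #Arrow P β j u
  #Arrow-μ-from P u true  j = q-μ-from P u j
  #Arrow-μ-from P u false j = q-μ-to P u j

  module QuiverFacts {P : IceQuiver n m} (isQuiver : IsQuiver (arr P)) where

    no2Cycle : ∀ i j → q P i j ≡ 0 ⊎ q P j i ≡ 0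
    no2Cycle i j = proj₂ isQuiver (mut m i) (mut m j)

    q-asym : ∀ {i j} → 0 < q P i j → 0 < q P j i → ⊥
    q-asym {i} {j} i→j j→i = [ n>0⇒n≢0 i→j , n>0⇒n≢0 j→i ]′ (no2Cycle i j)

    q-irrefl : ∀ {i j} → 0 < q P i j → i ≢ j
    q-irrefl {i} i→j refl = n>0⇒n≢0 i→j (proj₁ isQuiver (mut m i))

    c-no2Cycle : ∀ i f → c⁺ P i f ≡ 0 ⊎ c⁻ P i f ≡ 0
    c-no2Cycle i f = proj₂ isQuiver (mut m i) (frz n f)

    q-reverse≡0 : ∀ {i j} → 0 < q P i j → q P j i ≡ 0
    q-reverse≡0 {i} {j} i→j = [ ⊥-elim ∘ n>0⇒n≢0 i→j , id ]′ (no2Cycle i j)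

  -- Fork P (just r): the mutable part of P is a fork with point of return r; Fork P nothing: it is
  -- abundant and acyclic. In both cases acyclicity (off r) is only required of triangles, which
  -- suffices for abundant quivers.
  Avoids : Maybe (Fin n) → Fin n → Set
  Avoids nothing  _ = ⊤
  Avoids (just r) x = x ≢ r

  ReturnsAt : IceQuiver n m → Maybe (Fin n) → Set
  ReturnsAt P nothing  = ⊤
  ReturnsAt P (just r) = ∀ i j → 0 < q P i r → 0 < q P r j → q P i r < q P j i × q P r j < q P j i

  record Fork (P : IceQuiver n m) (r? : Maybe (Fin n)) : Set where
    field
      isQuiver   : IsQuiver (arr P)
      abundant   : Abundant (q P)
      noTriangle : ∀ a b c → Avoids r? a → Avoids r? b → Avoids r? c →
                   0 < q P a b → 0 < q P b c → 0 < q P c a → ⊥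
      returns    : ReturnsAt P r?

  module ForkFacts {P : IceQuiver n m} {r? : Maybe (Fin n)} (F : Fork P r?) where
    open Fork F
    open QuiverFacts isQuiver public

    q-connex : ∀ {i j} → i ≢ j → 0 < q P i j ⊎ 0 < q P j i
    q-connex {i} {j} i≢j with 0 ℕ.<? q P i j | 0 ℕ.<? q P j i
    ... | yes i→j | _       = inj₁ i→j
    ... | no _    | yes j→i = inj₂ j→i
    ... | no i↛j  | no j↛i  = ⊥-elim (<⇒≱ no-arrows (abundant i j i≢j))
      where
      no-arrows : q P i j + q P j i < 2
      no-arrows rewrite 0≮n⇒n≡0 i↛j | 0≮n⇒n≡0 j↛i = s≤s z≤n

    q≥2 : ∀ {i j} → 0 < q P i j → 2 ≤ q P i j
    q≥2 {i} {j} i→j = subst (2 ≤_) (trans (cong (q P i j +_) (q-reverse≡0 i→j)) (+-identityʳ _))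
                             (abundant i j (q-irrefl i→j))

    Arrow-asym : ∀ β {i j} → Arrow P β i j → Arrow P (not β) i j → ⊥
    Arrow-asym true  = q-asym
    Arrow-asym false = q-asym

    Arrow-connex : ∀ β {i j} → i ≢ j → Arrow P β i j ⊎ Arrow P (not β) i j
    Arrow-connex true  = q-connex
    Arrow-connex false = Sum.swap ∘ q-connex

    #Arrow≥2 : ∀ β {i j} → Arrow P β i j → 2 ≤ #Arrow P β i j
    #Arrow≥2 true  = q≥2
    #Arrow≥2 false = q≥2

  Arrow-returns : ∀ {P r} → Fork P (just r) → ∀ β {a b} →
                  Arrow P β a r → Arrow P β r b → Arrow P β b a
  Arrow-returns F true  {a} {b} a→r r→b = ≤-trans (s≤s z≤n) (proj₁ (Fork.returns F a b a→r r→b))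
  Arrow-returns F false {a} {b} a←r r←b = ≤-trans (s≤s z≤n) (proj₁ (Fork.returns F b a r←b a←r))

  -- The triangle a → u → b → a must pass through the point of return, whose inequalities give the
  -- bounds.
  triangle-path-bound : ∀ {P r? u a b} → Fork P r? → Avoids r? u →
                        0 < q P a u → 0 < q P u b → 0 < q P b a →
                        q P a u < q P a u * q P u b ∸ q P b a × q P u b < q P a u * q P u b ∸ q P b a
  triangle-path-bound {r? = nothing} F _ a→u u→b b→a =
    ⊥-elim (Fork.noTriangle F _ _ _ tt tt tt a→u u→b b→a)
  triangle-path-bound {P} {just r} {u} {a} {b} F u≢r a→u u→b b→a with a F.≟ r | b F.≟ r
  ... | no a≢r | no b≢r = ⊥-elim (Fork.noTriangle F a u b a≢r u≢r b≢r a→u u→b b→a)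
  ... | yes refl | _ =
    let (b→a<u→b , a→u<u→b) = Fork.returns F b u b→a a→u
        bound = n<m*n∸o (ForkFacts.q≥2 F a→u) b→a<u→b
    in <-trans a→u<u→b bound , bound
  ... | no _ | yes refl rewrite *-comm (q P a u) (q P u b) =
    let (u→b<a→u , b→a<a→u) = Fork.returns F u a u→b b→a
        bound = n<m*n∸o (ForkFacts.q≥2 F u→b) b→a<a→u
    in bound , <-trans u→b<a→u bound

  module Mutation {P : IceQuiver n m} {r? : Maybe (Fin n)} (F : Fork P r?)
                  (u : Fin n) (u-avoids : Avoids r? u) where
    open Fork F
    open ForkFacts F

    P′ : IceQuiver n m
    P′ = μ u P

    isQuiver′ : IsQuiver (arr P′)
    isQuiver′ = mutateQ-isQuiver (mut m u) (arr P) isQuiver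

    module P′ = QuiverFacts isQuiver′

    q-μ-path : ∀ {a b} → a ≢ u → b ≢ u → 0 < q P a u → 0 < q P u b →
               q P a u < q P′ a b × q P u b < q P′ a b
    q-μ-path {a} {b} a≢u b≢u a→u u→b rewrite q-μ-away P u a≢u b≢u | q-reverse≡0 u→b
      with q-connex (λ a≡b → q-asym a→u (subst (λ x → 0 < q P u x) (sym a≡b) u→b))
    ... | inj₁ a→b rewrite q-reverse≡0 a→b =
      +-mono-<-≤ a→b (m≤m*n′ (q P a u) u→b) , +-mono-<-≤ a→b (n≤m*n′ (q P u b) a→u)
    ... | inj₂ b→a rewrite q-reverse≡0 b→a | +-identityʳ (q P b a) =
      triangle-path-bound F u-avoids a→u u→b b→a

    q-μ-no-path : ∀ {a b} → a ≢ u → b ≢ u → ¬ (0 < q P a u × 0 < q P u b) →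
                  ¬ (0 < q P b u × 0 < q P u a) → q P′ a b ≡ q P a b
    q-μ-no-path {a} {b} a≢u b≢u no-a→u→b no-b→u→a
      rewrite q-μ-away P u a≢u b≢u
            | ¬[0<m×0<n]⇒m*n≡0 no-a→u→b | ¬[0<m×0<n]⇒m*n≡0 no-b→u→a
            | +-identityʳ (q P a b) | +-identityʳ (q P b a) = m≡0⊎n≡0⇒m∸n≡m (no2Cycle a b)

    q-μ-keeps : ∀ {a b} → a ≢ u → b ≢ u → 0 < q P a b → ¬ (0 < q P b u × 0 < q P u a) →
                0 < q P′ a b
    q-μ-keeps {a} {b} a≢u b≢u a→b no-b→u→a with 0 ℕ.<? q P a u | 0 ℕ.<? q P u b
    ... | yes a→u | yes u→b = <-trans a→u (proj₁ (q-μ-path a≢u b≢u a→u u→b))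
    ... | no a↛u  | _       = subst (0 <_) (sym (q-μ-no-path a≢u b≢u (a↛u ∘ proj₁) no-b→u→a)) a→b
    ... | yes _   | no u↛b  = subst (0 <_) (sym (q-μ-no-path a≢u b≢u (u↛b ∘ proj₂) no-b→u→a)) a→b

    Arrow-μ-keeps : ∀ β {a b} → a ≢ u → b ≢ u → Arrow P β a b → ¬ (Arrow P β b u × Arrow P β u a) →
                    Arrow P′ β a b
    Arrow-μ-keeps true  a≢u b≢u a→b no-path = q-μ-keeps a≢u b≢u a→b no-path
    Arrow-μ-keeps false a≢u b≢u a←b no-path = q-μ-keeps b≢u a≢u a←b (no-path ∘ Prod.swap)

    Arrow-μ-path : ∀ β {a b} → a ≢ u → b ≢ u → Arrow P β a u → Arrow P β u b → Arrow P′ β a b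
    Arrow-μ-path true  a≢u b≢u a→u u→b = ≤-<-trans z≤n (proj₁ (q-μ-path a≢u b≢u a→u u→b))
    Arrow-μ-path false a≢u b≢u a←u u←b = ≤-<-trans z≤n (proj₁ (q-μ-path b≢u a≢u u←b a←u))

    q-μ-path≥2 : ∀ {a b} → a ≢ u → b ≢ u → 0 < q P a u → 0 < q P u b → 2 ≤ q P′ a b
    q-μ-path≥2 a≢u b≢u a→u u→b = ≤-trans (q≥2 a→u) (<⇒≤ (proj₁ (q-μ-path a≢u b≢u a→u u→b)))

    abundant′ : Abundant (q P′)
    abundant′ i j i≢j with i F.≟ u | j F.≟ u
    ... | yes refl | _ rewrite q-μ-from P u j | q-μ-to P u j =
      subst (2 ≤_) (+-comm (q P u j) (q P j u)) (abundant u j i≢j)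
    ... | no _ | yes refl rewrite q-μ-from P u i | q-μ-to P u i = abundant u i (i≢j ∘ sym)
    ... | no i≢u | no j≢u
      with (0 ℕ.<? q P i u) ×-dec (0 ℕ.<? q P u j) | (0 ℕ.<? q P j u) ×-dec (0 ℕ.<? q P u i)
    ... | yes (i→u , u→j) | _                = ≤-trans (q-μ-path≥2 i≢u j≢u i→u u→j) (m≤m+n _ _)
    ... | no _            | yes (j→u , u→i)  = ≤-trans (q-μ-path≥2 j≢u i≢u j→u u→i) (m≤n+m _ _)
    ... | no no-i→u→j     | no no-j→u→i      =
      subst (2 ≤_) (sym (cong₂ _+_ (q-μ-no-path i≢u j≢u no-i→u→j no-j→u→i)
                                   (q-μ-no-path j≢u i≢u no-j→u→i no-i→u→j)))
            (abundant i j i≢j)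

    returns′ : ReturnsAt P′ (just u)
    returns′ i j i→u u→j rewrite q-μ-to P u i | q-μ-from P u j =
      Prod.swap (q-μ-path (q-irrefl u→j) (q-irrefl i→u ∘ sym) u→j i→u)

    q-μ-reflects : ∀ {x y} → x ≢ u → y ≢ u → Avoids r? x → Avoids r? y →
                   0 < q P′ x y → 0 < q P x y
    q-μ-reflects {x} {y} x≢u y≢u x-avoids y-avoids x→y with q-connex (P′.q-irrefl {x} {y} x→y)
    ... | inj₁ x→y-before = x→y-before
    ... | inj₂ y→x = ⊥-elim (P′.q-asym {x} {y} x→y (q-μ-keeps y≢u x≢u y→x
                       (λ (x→u , u→y) → noTriangle x u y x-avoids u-avoids y-avoids x→u u→y y→x)))

  μ-noTriangle-via-return : ∀ {P r} (F : Fork P (just r)) {u} (u≢r : u ≢ r) {y z} → y ≢ u → z ≢ u →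
                            0 < q (μ u P) r y → 0 < q (μ u P) y z → 0 < q (μ u P) z r → ⊥
  μ-noTriangle-via-return {P} {r} F {u} u≢r {y} {z} y≢u z≢u r→y y→z z→r =
    [ via-r→u , via-u→r ]′ (q-connex (u≢r ∘ sym))
    where
    open ForkFacts F
    open Mutation F u u≢r
    via-r→u : 0 < q P r u → ⊥
    via-r→u r→u with q-connex z≢u
    ... | inj₂ u→z = P′.q-asym {z} {r} z→r (Arrow-μ-path true (u≢r ∘ sym) z≢u r→u u→z)
    ... | inj₁ z→u with q-connex (P′.q-irrefl {z} {r} z→r)
    ... | inj₂ r→z        = P′.q-asym {z} {r} z→r (q-μ-keeps (u≢r ∘ sym) z≢u r→z (q-asym r→u ∘ proj₂))
    ... | inj₁ z→r-before = q-asym z→u (Arrow-returns F true z→r-before r→u)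
    via-u→r : 0 < q P u r → ⊥
    via-u→r u→r with q-connex y≢u
    ... | inj₁ y→u = P′.q-asym {r} {y} r→y (Arrow-μ-path true y≢u (u≢r ∘ sym) y→u u→r)
    ... | inj₂ u→y with q-connex (P′.q-irrefl {r} {y} r→y)
    ... | inj₂ y→r        = P′.q-asym {r} {y} r→y (q-μ-keeps y≢u (u≢r ∘ sym) y→r (q-asym u→r ∘ proj₁))
    ... | inj₁ r→y-before = q-asym u→y (Arrow-returns F true u→r r→y-before)

  μ-noTriangle : ∀ {P r?} (F : Fork P r?) u → Avoids r? u → ∀ a b c → a ≢ u → b ≢ u → c ≢ u →
                 0 < q (μ u P) a b → 0 < q (μ u P) b c → 0 < q (μ u P) c a → ⊥
  μ-noTriangle {r? = nothing} F u _ a b c a≢u b≢u c≢u a→b b→c c→a =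
    Fork.noTriangle F a b c tt tt tt (q-μ-reflects a≢u b≢u tt tt a→b)
                                     (q-μ-reflects b≢u c≢u tt tt b→c)
                                     (q-μ-reflects c≢u a≢u tt tt c→a)
    where open Mutation F u tt
  μ-noTriangle {r? = just r} F u u≢r a b c a≢u b≢u c≢u a→b b→c c→a
    with a F.≟ r | b F.≟ r | c F.≟ r
  ... | yes refl | _        | _        = μ-noTriangle-via-return F u≢r b≢u c≢u a→b b→c c→a
  ... | no _     | yes refl | _        = μ-noTriangle-via-return F u≢r c≢u a≢u b→c c→a a→b
  ... | no _     | no _     | yes refl = μ-noTriangle-via-return F u≢r a≢u b≢u c→a a→b b→c
  ... | no a≢r   | no b≢r   | no c≢r   =
    Fork.noTriangle F a b c a≢r b≢r c≢r (q-μ-reflects a≢u b≢u a≢r b≢r a→b)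
                                        (q-μ-reflects b≢u c≢u b≢r c≢r b→c)
                                        (q-μ-reflects c≢u a≢u c≢r a≢r c→a)
    where open Mutation F u u≢r

  fork-μ : ∀ {P r?} → Fork P r? → ∀ u → Avoids r? u → Fork (μ u P) (just u)
  fork-μ F u u-avoids = record
    { isQuiver   = isQuiver′
    ; abundant   = abundant′
    ; noTriangle = μ-noTriangle F u u-avoids
    ; returns    = returns′
    }
    where open Mutation F u u-avoids

  cAlong cAgainst : IceQuiver n m → Bool → Fin n → Fin m → ℕ
  cAlong   P true  = c⁺ P
  cAlong   P false = c⁻ P
  cAgainst P true  = c⁻ P
  cAgainst P false = c⁺ P

  -- HasSign P i true: c_i is green; HasSign P i false: c_i is red (stated on the arrow counts).
  HasSign : IceQuiver n m → Fin n → Bool → Set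
  HasSign P i β = (∀ f → cAgainst P β i f ≡ 0) × ¬ (∀ f → cAlong P β i f ≡ 0)

  |c| : IceQuiver n m → Fin n → Fin m → ℕ
  |c| P i f = c⁺ P i f + c⁻ P i f

  |c|≡cAlong : ∀ {P i} β → HasSign P i β → ∀ f → |c| P i f ≡ cAlong P β i f
  |c|≡cAlong {P} {i} true  (against≡0 , _) f = trans (cong (c⁺ P i f +_) (against≡0 f)) (+-identityʳ _)
  |c|≡cAlong {P} {i} false (against≡0 , _) f = cong (_+ c⁻ P i f) (against≡0 f)

  cAgainst≡cAlong-not : ∀ P β i f → cAgainst P β i f ≡ cAlong P (not β) i f
  cAgainst≡cAlong-not P true  i f = refl
  cAgainst≡cAlong-not P false i f = refl

  hasSign-transport : ∀ {P P′ i j} β β′ → (∀ f → cAlong P′ β′ j f ≡ cAlong P β i f) →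
                      (∀ f → cAgainst P′ β′ j f ≡ cAgainst P β i f) → HasSign P i β → HasSign P′ j β′
  hasSign-transport _ _ along against (against≡0 , ¬along≡0) =
    (λ f → trans (against f) (against≡0 f)) ,
    (λ along′≡0 → ¬along≡0 (λ f → trans (sym (along f)) (along′≡0 f)))

  SameRow : IceQuiver n m → Fin n → IceQuiver n m → Fin n → Set
  SameRow P′ j P i = ∀ f → c⁺ P′ j f ≡ c⁺ P i f × c⁻ P′ j f ≡ c⁻ P i f

  hasSign-sameRow : ∀ {P P′ i j} β → SameRow P′ j P i → HasSign P i β → HasSign P′ j β
  hasSign-sameRow {P} {P′} {i} {j} true  same =
    hasSign-transport {P} {P′} {i} {j} true true (proj₁ ∘ same) (proj₂ ∘ same)
  hasSign-sameRow {P} {P′} {i} {j} false same =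
    hasSign-transport {P} {P′} {i} {j} false false (proj₂ ∘ same) (proj₁ ∘ same)

  hasSign-μ-self : ∀ {P u} β → HasSign P u β → HasSign (μ u P) u (not β)
  hasSign-μ-self {P} {u} true  =
    hasSign-transport {P} {μ u P} {u} {u} true false (c⁻-μ-self P u) (c⁺-μ-self P u)
  hasSign-μ-self {P} {u} false =
    hasSign-transport {P} {μ u P} {u} {u} false true (c⁺-μ-self P u) (c⁻-μ-self P u)

  hasSign-μ-self⁻¹ : ∀ {P u} β → HasSign (μ u P) u β → HasSign P u (not β)
  hasSign-μ-self⁻¹ {P} {u} true  =
    hasSign-transport {μ u P} {P} {u} {u} true false (sym ∘ c⁺-μ-self P u) (sym ∘ c⁻-μ-self P u)
  hasSign-μ-self⁻¹ {P} {u} false =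
    hasSign-transport {μ u P} {P} {u} {u} false true (sym ∘ c⁻-μ-self P u) (sym ∘ c⁺-μ-self P u)

  module SignMutation {P : IceQuiver n m} (isQuiver : IsQuiver (arr P)) (u : Fin n) where
    open QuiverFacts {P = P} isQuiver using (c-no2Cycle)

    P′ : IceQuiver n m
    P′ = μ u P

    c-μ-unchanged : ∀ β {j} → j ≢ u → #Arrow P β j u ≡ 0 → (∀ f → cAgainst P β u f ≡ 0) →
                    SameRow P′ j P j
    c-μ-unchanged true {j} j≢u j↛u u-against≡0 f
      rewrite c⁺-μ-away P u f j≢u | c⁻-μ-away P u f j≢u | j↛u | u-against≡0 f
            | +-identityʳ (c⁺ P j f) | +-identityʳ (c⁻ P j f)
      = m≡0⊎n≡0⇒m∸n≡m (c-no2Cycle j f) , m≡0⊎n≡0⇒n∸m≡n (c-no2Cycle j f)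
    c-μ-unchanged false {j} j≢u u↛j u-against≡0 f
      rewrite c⁺-μ-away P u f j≢u | c⁻-μ-away P u f j≢u | u↛j | u-against≡0 f
            | *-zeroʳ (q P j u) | *-zeroʳ (c⁻ P u f)
            | +-identityʳ (c⁺ P j f) | +-identityʳ (c⁻ P j f)
      = m≡0⊎n≡0⇒m∸n≡m (c-no2Cycle j f) , m≡0⊎n≡0⇒n∸m≡n (c-no2Cycle j f)


    hasSign-μ-unchanged : ∀ β γ {j} → j ≢ u → ¬ Arrow P β j u → HasSign P u β →
                          HasSign P j γ → HasSign P′ j γ
    hasSign-μ-unchanged β γ j≢u j↛u (u-against≡0 , _) =
      hasSign-sameRow γ (c-μ-unchanged β j≢u (0≮n⇒n≡0 j↛u) u-against≡0)

    c-μ-sameSign : ∀ β {j} → j ≢ u → HasSign P u β → HasSign P j β → ∀ f →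
                   cAlong P′ β j f ≡ cAlong P β j f + #Arrow P β j u * cAlong P β u f ×
                   cAgainst P′ β j f ≡ 0
    c-μ-sameSign true {j} j≢u (u-against≡0 , _) (j-against≡0 , _) f
      rewrite c⁺-μ-away P u f j≢u | c⁻-μ-away P u f j≢u | u-against≡0 f | j-against≡0 f
      = refl , 0∸n≡0 (c⁺ P j f + q P j u * c⁺ P u f)
    c-μ-sameSign false {j} j≢u (u-against≡0 , _) (j-against≡0 , _) f
      rewrite c⁺-μ-away P u f j≢u | c⁻-μ-away P u f j≢u | u-against≡0 f | j-against≡0 f
            | *-zeroʳ (q P j u)
      = cong (c⁻ P j f +_) (*-comm (c⁻ P u f) (q P u j)) , 0∸n≡0 (c⁻ P j f + c⁻ P u f * q P u j)

    -- At least two arrows j → u add at least 2|c_u| ≥ |c_u| + |c_j| to c_j, against its sign.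
    c-μ-oppositeSign : ∀ β {j} → j ≢ u → HasSign P u β → HasSign P j (not β) → 2 ≤ #Arrow P β j u →
                       (∀ f → cAgainst P β j f ≤ cAlong P β u f) →
                       ∀ f → cAgainst P′ β j f ≡ 0 × cAlong P β u f ≤ cAlong P′ β j f
    c-μ-oppositeSign true {j} j≢u (u-against≡0 , _) (j-along≡0 , _) 2≤#j→u j≤u f
      rewrite c⁺-μ-away P u f j≢u | c⁻-μ-away P u f j≢u | u-against≡0 f | j-along≡0 f
            | +-identityʳ (c⁻ P j f)
      = o∸m*n≡0 2≤#j→u (j≤u f) , n≤m*n∸o 2≤#j→u (j≤u f)
    c-μ-oppositeSign false {j} j≢u (u-against≡0 , _) (j-along≡0 , _) 2≤#j→u j≤u f
      rewrite c⁺-μ-away P u f j≢u | c⁻-μ-away P u f j≢u | u-against≡0 f | j-along≡0 f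
            | *-zeroʳ (q P j u) | +-identityʳ (c⁺ P j f) | *-comm (c⁻ P u f) (q P u j)
      = o∸m*n≡0 2≤#j→u (j≤u f) , n≤m*n∸o 2≤#j→u (j≤u f)

    |c|-μ-self : ∀ f → |c| P′ u f ≡ |c| P u f
    |c|-μ-self f rewrite c⁺-μ-self P u f | c⁻-μ-self P u f = +-comm (c⁻ P u f) (c⁺ P u f)

    hasSign-μ-same : ∀ β {j} → j ≢ u → HasSign P u β → HasSign P j β →
                     HasSign P′ j β × (Arrow P β j u → ∀ f → |c| P u f ≤ |c| P′ j f)
    hasSign-μ-same β {j} j≢u u-sign j-sign = j-sign′ , grows
      where
      row : ∀ f → cAlong P′ β j f ≡ cAlong P β j f + #Arrow P β j u * cAlong P β u f ×
                  cAgainst P′ β j f ≡ 0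
      row = c-μ-sameSign β j≢u u-sign j-sign
      j-sign′ : HasSign P′ j β
      j-sign′ = proj₂ ∘ row ,
                λ along≡0 → proj₂ j-sign (λ f → m+n≡0⇒m≡0 _ (trans (sym (proj₁ (row f))) (along≡0 f)))
      grows : Arrow P β j u → ∀ f → |c| P u f ≤ |c| P′ j f
      grows j→u f = begin
        |c| P u f                                        ≡⟨ |c|≡cAlong β u-sign f ⟩
        cAlong P β u f                                   ≤⟨ n≤m*n′ (cAlong P β u f) j→u ⟩
        #Arrow P β j u * cAlong P β u f                  ≤⟨ m≤n+m _ (cAlong P β j f) ⟩
        cAlong P β j f + #Arrow P β j u * cAlong P β u f ≡⟨ sym (proj₁ (row f)) ⟩
        cAlong P′ β j f                                  ≡⟨ sym (|c|≡cAlong β j-sign′ f) ⟩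
        |c| P′ j f                                       ∎
        where open ≤-Reasoning

    hasSign-μ-opposite : ∀ β {j} → j ≢ u → HasSign P u β → HasSign P j (not β) → 2 ≤ #Arrow P β j u →
                         (∀ f → |c| P j f ≤ |c| P u f) →
                         HasSign P′ j β × (∀ f → |c| P u f ≤ |c| P′ j f)
    hasSign-μ-opposite β {j} j≢u u-sign j-sign 2≤#j→u j≤u = j-sign′ , grows
      where
      against≤ : ∀ f → cAgainst P β j f ≤ cAlong P β u f
      against≤ f = subst₂ _≤_ (trans (|c|≡cAlong (not β) j-sign f) (sym (cAgainst≡cAlong-not P β j f)))
                              (|c|≡cAlong β u-sign f) (j≤u f)
      row : ∀ f → cAgainst P′ β j f ≡ 0 × cAlong P β u f ≤ cAlong P′ β j f
      row = c-μ-oppositeSign β j≢u u-sign j-sign 2≤#j→u against≤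
      j-sign′ : HasSign P′ j β
      j-sign′ = proj₁ ∘ row ,
                λ along≡0 → proj₂ u-sign λ f →
                  n≤0⇒n≡0 (subst (cAlong P β u f ≤_) (along≡0 f) (proj₂ (row f)))
      grows : ∀ f → |c| P u f ≤ |c| P′ j f
      grows f = subst₂ _≤_ (sym (|c|≡cAlong β u-sign f)) (sym (|c|≡cAlong β j-sign′ f)) (proj₂ (row f))

  -- Conditions (b)–(d) rephrased in terms of arrows once every row has a sign; in this form they
  -- propagate along mutations.
  record SignPattern (P : IceQuiver n m) (v : Fin n) (s : Fin n → Bool) : Set where
    field
      hasSign : ∀ i → HasSign P i (s i)
      condB   : ∀ j → j ≢ v → Arrow P (s j) v j → s j ≢ s v → ∀ f → |c| P v f ≤ |c| P j f
      condC   : ∀ j → j ≢ v → s j ≡ s v → Arrow P (s v) v j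
      condD   : ∀ i j → i ≢ v → j ≢ v → s i ≢ s j → Arrow P (s i) i j

  Admissible : IceQuiver n m → Fin n → Set
  Admissible P v = Fork P (just v) × ∃ (SignPattern P v)

  module AdmissibleMutation {P : IceQuiver n m} {v : Fin n} (F : Fork P (just v)) {s : Fin n → Bool}
                            (S : SignPattern P v s) (u : Fin n) (u≢v : u ≢ v) where
    open Fork F
    open ForkFacts F
    open Mutation F u u≢v
    open SignMutation isQuiver u
      using (hasSign-μ-unchanged; hasSign-μ-same; hasSign-μ-opposite; |c|-μ-self)
    open SignPattern S

    v≢u : v ≢ u
    v≢u = u≢v ∘ sym

    -- Joined to u in u's colour, c_v gains at least 2c_u, which dominates c_v by condB.
    sv′ : Bool
    sv′ with Arrow? P (s u) v u
    ... | yes _ = s u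
    ... | no _  = s v

    sv′-v→u : Arrow P (s u) v u → sv′ ≡ s u
    sv′-v→u v→u with Arrow? P (s u) v u
    ... | yes _   = refl
    ... | no v↛u = ⊥-elim (v↛u v→u)

    sv′-v↛u : ¬ Arrow P (s u) v u → sv′ ≡ s v
    sv′-v↛u v↛u with Arrow? P (s u) v u
    ... | yes v→u = ⊥-elim (v↛u v→u)
    ... | no _    = refl

    s′ : Fin n → Bool
    s′ k with k F.≟ u | k F.≟ v
    ... | yes _ | _     = not (s u)
    ... | no _  | yes _ = sv′
    ... | no _  | no _  = s k

    s′-u : s′ u ≡ not (s u)
    s′-u with u F.≟ u
    ... | yes _   = refl
    ... | no u≢u = ⊥-elim (u≢u refl)

    s′-v : s′ v ≡ sv′
    s′-v with v F.≟ u | v F.≟ v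
    ... | yes v≡u | _     = ⊥-elim (v≢u v≡u)
    ... | no _    | yes _ = refl
    ... | no _    | no v≢v = ⊥-elim (v≢v refl)

    s′-other : ∀ {k} → k ≢ u → k ≢ v → s′ k ≡ s k
    s′-other {k} k≢u k≢v with k F.≟ u | k F.≟ v
    ... | yes k≡u | _     = ⊥-elim (k≢u k≡u)
    ... | no _    | yes k≡v = ⊥-elim (k≢v k≡v)
    ... | no _    | no _  = refl

    s-u≢s-v-if-v↛u : ¬ Arrow P (s u) v u → s u ≢ s v
    s-u≢s-v-if-v↛u v↛u su≡sv = v↛u (subst (λ b → Arrow P b v u) (sym su≡sv) (condC u u≢v su≡sv))

    s≡su-if-into-u : ∀ {k} → k ≢ v → Arrow P (s u) k u → s k ≡ s u
    s≡su-if-into-u {k} k≢v k→u with s k BP.≟ s u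
    ... | yes sk≡su = sk≡su
    ... | no sk≢su  = ⊥-elim (Arrow-asym (s u) k→u
                        (subst (λ b → Arrow P b k u) (BP.¬-not sk≢su) (condD k u k≢v u≢v sk≢su)))

    NewRow : Fin n → Set
    NewRow k = HasSign P′ k (s′ k) × (Arrow P (s u) k u → ∀ f → |c| P u f ≤ |c| P′ k f)

    newRow-v→u : Arrow P (s u) v u →
                 HasSign P′ v (s u) × (Arrow P (s u) v u → ∀ f → |c| P u f ≤ |c| P′ v f)
    newRow-v→u v→u with s u BP.≟ s v
    ... | yes su≡sv = hasSign-μ-same (s u) v≢u (hasSign u) (subst (HasSign P v) (sym su≡sv) (hasSign v))
    ... | no su≢sv  = Prod.map₂ const
      (hasSign-μ-opposite (s u) v≢u (hasSign u)
                          (subst (HasSign P v) (BP.¬-not (su≢sv ∘ sym)) (hasSign v))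
                          (#Arrow≥2 (s u) v→u) (condB u u≢v v→u su≢sv))

    newRow-v : NewRow v
    newRow-v with Arrow? P (s u) v u
    ... | yes v→u = Prod.map₁ (subst (HasSign P′ v) (sym (trans s′-v (sv′-v→u v→u)))) (newRow-v→u v→u)
    ... | no v↛u  =
      subst (HasSign P′ v) (sym (trans s′-v (sv′-v↛u v↛u)))
            (hasSign-μ-unchanged (s u) (s v) v≢u v↛u (hasSign u) (hasSign v)) ,
      ⊥-elim ∘ v↛u

    newRow : ∀ k → k ≢ u → NewRow k
    newRow k k≢u with ≡⊎≢ k v
    ... | inj₁ refl = newRow-v
    ... | inj₂ k≢v with Arrow? P (s u) k u
    ...   | yes k→u = Prod.map₁ (subst (HasSign P′ k) (sym (trans (s′-other k≢u k≢v) sk≡su)))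
                        (hasSign-μ-same (s u) k≢u (hasSign u) (subst (HasSign P k) sk≡su (hasSign k)))
      where
      sk≡su : s k ≡ s u
      sk≡su = s≡su-if-into-u k≢v k→u
    ...   | no k↛u  =
      subst (HasSign P′ k) (sym (s′-other k≢u k≢v))
            (hasSign-μ-unchanged (s u) (s k) k≢u k↛u (hasSign u) (hasSign k)) ,
      ⊥-elim ∘ k↛u

    hasSign′ : ∀ i → HasSign P′ i (s′ i)
    hasSign′ i with ≡⊎≢ i u
    ... | inj₁ refl = subst (HasSign P′ u) (sym s′-u) (hasSign-μ-self (s u) (hasSign u))
    ... | inj₂ i≢u  = proj₁ (newRow i i≢u)

    condB′ : ∀ j → j ≢ u → Arrow P′ (s′ j) u j → s′ j ≢ s′ u → ∀ f → |c| P′ u f ≤ |c| P′ j f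
    condB′ j j≢u u→j s′j≢s′u f =
      subst (_≤ |c| P′ j f) (sym (|c|-μ-self f)) (proj₂ (newRow j j≢u) j→u f)
      where
      s′j≡su : s′ j ≡ s u
      s′j≡su = ≢-not⇒≡ (subst (s′ j ≢_) s′-u s′j≢s′u)
      j→u : Arrow P (s u) j u
      j→u = subst (0 <_) (#Arrow-μ-from P u (s u) j) (subst (λ b → Arrow P′ b u j) s′j≡su u→j)

    into-u-if-s′≡¬su : ∀ j → j ≢ u → s′ j ≡ not (s u) → Arrow P (not (s u)) j u
    into-u-if-s′≡¬su j j≢u s′j≡¬su with ≡⊎≢ j v
    ... | inj₂ j≢v = subst (λ b → Arrow P b j u) sj≡¬su
                       (condD j u j≢v u≢v (λ sj≡su → BP.not-¬ refl (trans (sym sj≡su) sj≡¬su)))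
      where
      sj≡¬su : s j ≡ not (s u)
      sj≡¬su = trans (sym (s′-other j≢u j≢v)) s′j≡¬su
    ... | inj₁ refl with Arrow? P (s u) j u
    ...   | yes v→u = ⊥-elim (BP.not-¬ refl (trans (sym (trans s′-v (sv′-v→u v→u))) s′j≡¬su))
    ...   | no v↛u  = [ ⊥-elim ∘ v↛u , id ]′ (Arrow-connex (s u) j≢u)

    condC′ : ∀ j → j ≢ u → s′ j ≡ s′ u → Arrow P′ (s′ u) u j
    condC′ j j≢u s′j≡s′u = subst (λ b → Arrow P′ b u j) (sym s′-u)
      (subst (0 <_) (sym (#Arrow-μ-from P u (not (s u)) j)) (into-u-if-s′≡¬su j j≢u (trans s′j≡s′u s′-u)))

    condD′-from-v : ∀ j → j ≢ u → j ≢ v → s′ v ≢ s j → Arrow P′ (s′ v) v j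
    condD′-from-v j j≢u j≢v s′v≢sj with Arrow? P (s u) v u
    ... | yes v→u = subst (λ b → Arrow P′ b v j) (sym s′v≡su) (Arrow-μ-path (s u) v≢u j≢u v→u u→j)
      where
      s′v≡su : s′ v ≡ s u
      s′v≡su = trans s′-v (sv′-v→u v→u)
      su≢sj : s u ≢ s j
      su≢sj = s′v≢sj ∘ trans s′v≡su
      u→j : Arrow P (s u) u j
      u→j = Arrow-unflip (s u)
              (subst (λ b → Arrow P b j u) (BP.¬-not (su≢sj ∘ sym)) (condD j u j≢v u≢v (su≢sj ∘ sym)))
    ... | no v↛u = subst (λ b → Arrow P′ b v j) (sym s′v≡¬su) v→j′
      where
      β : Bool
      β = not (s u)
      s′v≡¬su : s′ v ≡ β
      s′v≡¬su = trans (trans s′-v (sv′-v↛u v↛u)) (BP.¬-not (s-u≢s-v-if-v↛u v↛u ∘ sym))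
      v→u : Arrow P β v u
      v→u = [ ⊥-elim ∘ v↛u , id ]′ (Arrow-connex (s u) v≢u)
      v→j′ : Arrow P′ β v j
      v→j′ with Arrow? P β u j
      ... | yes u→j = Arrow-μ-path β v≢u j≢u v→u u→j
      ... | no u↛j  = Arrow-μ-keeps β v≢u j≢u v→j (λ (_ , u→v) → Arrow-asym β u→v (Arrow-flip β v→u))
        where
        v→j : Arrow P β v j
        v→j = [ id , (λ j→v → ⊥-elim (u↛j (Arrow-returns F β (Arrow-unflip β j→v) v→u))) ]′
                (Arrow-connex β (j≢v ∘ sym))

    condD′-to-v : ∀ i → i ≢ u → i ≢ v → s i ≢ s′ v → Arrow P′ (s i) i v
    condD′-to-v i i≢u i≢v si≢s′v with Arrow? P (s u) v u
    ... | yes v→u = Arrow-μ-path (s i) i≢u v≢u (condD i u i≢v u≢v si≢su)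
                      (subst (λ b → Arrow P b u v) (sym (BP.¬-not si≢su)) (Arrow-flip (s u) v→u))
      where
      si≢su : s i ≢ s u
      si≢su si≡su = si≢s′v (trans si≡su (sym (trans s′-v (sv′-v→u v→u))))
    ... | no v↛u = subst (λ b → Arrow P′ b i v) (sym si≡su) i→v′
      where
      β : Bool
      β = s u
      s′v≡¬β : s′ v ≡ not β
      s′v≡¬β = trans (trans s′-v (sv′-v↛u v↛u)) (BP.¬-not (s-u≢s-v-if-v↛u v↛u ∘ sym))
      si≡su : s i ≡ β
      si≡su = ≢-not⇒≡ (subst (s i ≢_) s′v≡¬β si≢s′v)
      v→u : Arrow P (not β) v u
      v→u = [ ⊥-elim ∘ v↛u , id ]′ (Arrow-connex β v≢u)
      u→v : Arrow P β u v
      u→v = Arrow-unflip β v→u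
      i→v′ : Arrow P′ β i v
      i→v′ with Arrow? P β i u
      ... | yes i→u = Arrow-μ-path β i≢u v≢u i→u u→v
      ... | no i↛u  = Arrow-μ-keeps β i≢u v≢u i→v (λ (v→u′ , _) → Arrow-asym β v→u′ v→u)
        where
        i→v : Arrow P β i v
        i→v = [ id , (λ v→i → ⊥-elim (i↛u (Arrow-returns F β u→v (Arrow-unflip β v→i)))) ]′
                (Arrow-connex β i≢v)

    condD′-away : ∀ i j → i ≢ u → j ≢ u → i ≢ v → j ≢ v → s i ≢ s j → Arrow P′ (s i) i j
    condD′-away i j i≢u j≢u i≢v j≢v si≢sj =
      Arrow-μ-keeps (s i) i≢u j≢u (condD i j i≢v j≢v si≢sj) no-path
      where
      no-path : ¬ (Arrow P (s i) j u × Arrow P (s i) u i)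
      no-path (j→u , u→i) with s u BP.≟ s i
      ... | yes su≡si = Arrow-asym (s i) j→u
                          (subst (λ b → Arrow P b j u) (BP.¬-not (si≢sj ∘ sym))
                                 (condD j u j≢v u≢v (λ sj≡su → si≢sj (sym (trans sj≡su su≡si)))))
      ... | no su≢si  = Arrow-asym (s i) (condD i u i≢v u≢v (su≢si ∘ sym)) (Arrow-flip (s i) u→i)

    condD′ : ∀ i j → i ≢ u → j ≢ u → s′ i ≢ s′ j → Arrow P′ (s′ i) i j
    condD′ i j i≢u j≢u s′i≢s′j with ≡⊎≢ i v | ≡⊎≢ j v
    ... | inj₁ refl | inj₁ refl = ⊥-elim (s′i≢s′j refl)
    ... | inj₁ refl | inj₂ j≢v  =
      condD′-from-v j j≢u j≢v (s′i≢s′j ∘ (λ e → trans e (sym (s′-other j≢u j≢v))))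
    ... | inj₂ i≢v  | inj₁ refl =
      subst (λ b → Arrow P′ b i j) (sym (s′-other i≢u i≢v))
            (condD′-to-v i i≢u i≢v (s′i≢s′j ∘ trans (s′-other i≢u i≢v)))
    ... | inj₂ i≢v  | inj₂ j≢v  =
      subst (λ b → Arrow P′ b i j) (sym (s′-other i≢u i≢v))
            (condD′-away i j i≢u j≢u i≢v j≢v
              (λ si≡sj → s′i≢s′j (trans (s′-other i≢u i≢v) (trans si≡sj (sym (s′-other j≢u j≢v))))))

    admissible′ : Admissible P′ u
    admissible′ = fork-μ F u u≢v , s′ , record
      { hasSign = hasSign′ ; condB = condB′ ; condC = condC′ ; condD = condD′ }

  admissible-μ : ∀ {P : IceQuiver n m} {v} → Admissible P v → ∀ u → u ≢ v → Admissible (μ u P) u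
  admissible-μ (F , s , S) = AdmissibleMutation.admissible′ F S

open import Data.Integer as ℤ using (ℤ; +_; 0ℤ; 1ℤ; -1ℤ; +≤+)
import Data.Integer.Properties as ZP

sign : Bool → ℤ
sign true  = 1ℤ
sign false = -1ℤ

signed : Bool → ℕ → ℤ
signed true  a = + a
signed false a = ℤ.- (+ a)

sign-injective : ∀ {a b} → sign a ≡ sign b → a ≡ b
sign-injective {true}  {true}  _ = refl
sign-injective {false} {false} _ = refl

-sign≡sign-not : ∀ b → ℤ.- sign b ≡ sign (not b)
-sign≡sign-not true  = refl
-sign≡sign-not false = refl

sign*signed : ∀ γ a → sign γ ℤ.* signed γ a ≡ + a
sign*signed true  a = ZP.*-identityˡ (+ a)
sign*signed false a = trans (ZP.-1*i≡-i (ℤ.- (+ a))) (ZP.neg-involutive (+ a))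

signed*signed≥0 : ∀ β a b → 0ℤ ℤ.≤ signed β a ℤ.* signed β b
signed*signed≥0 true  a b = subst (0ℤ ℤ.≤_) (ZP.pos-* a b) (+≤+ z≤n)
signed*signed≥0 false a b = subst (0ℤ ℤ.≤_) -a*-b≡a*b (+≤+ z≤n)
  where
  -a*-b≡a*b : + (a * b) ≡ ℤ.- (+ a) ℤ.* ℤ.- (+ b)
  -a*-b≡a*b = begin
    + (a * b)                ≡⟨ ZP.pos-* a b ⟩
    + a ℤ.* + b              ≡⟨ ZP.neg-involutive (+ a ℤ.* + b) ⟨
    ℤ.- ℤ.- (+ a ℤ.* + b)    ≡⟨ cong ℤ.-_ (ZP.neg-distribˡ-* (+ a) (+ b)) ⟩
    ℤ.- (ℤ.- (+ a) ℤ.* + b)  ≡⟨ ZP.neg-distribʳ-* (ℤ.- (+ a)) (+ b) ⟩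
    ℤ.- (+ a) ℤ.* ℤ.- (+ b)  ∎
    where open ≡-Reasoning

signed*signed-not≤0 : ∀ β a b → signed β a ℤ.* signed (not β) b ℤ.≤ 0ℤ
signed*signed-not≤0 true  a b =
  subst (ℤ._≤ 0ℤ) (trans (cong ℤ.-_ (ZP.pos-* a b)) (ZP.neg-distribʳ-* (+ a) (+ b))) ZP.neg-≤-pos
signed*signed-not≤0 false a b =
  subst (ℤ._≤ 0ℤ) (trans (cong ℤ.-_ (ZP.pos-* a b)) (ZP.neg-distribˡ-* (+ a) (+ b))) ZP.neg-≤-pos

sgn-green : ∀ {k} (c : Fin k → ℤ) → Green c → sgn c ≡ 1ℤ
sgn-green c green
  rewrite dec-true (all? (λ k → 0ℤ ℤ.≤? c k) ×-dec ¬? (all? (λ k → c k ℤ.≟ 0ℤ))) green = refl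

sgn-red : ∀ {k} (c : Fin k → ℤ) → Red c → sgn c ≡ -1ℤ
sgn-red c (c≤0 , c≢0)
  rewrite dec-false (all? (λ k → 0ℤ ℤ.≤? c k) ×-dec ¬? (all? (λ k → c k ℤ.≟ 0ℤ)))
                    (λ (0≤c , _) → c≢0 (λ k → ZP.≤-antisym (c≤0 k) (0≤c k)))
        | dec-true (all? (λ k → c k ℤ.≤? 0ℤ) ×-dec ¬? (all? (λ k → c k ℤ.≟ 0ℤ))) (c≤0 , c≢0) = refl

module _ {n m : ℕ} where

  Cmat≡signed : ∀ {P : IceQuiver n m} {i} γ → HasSign P i γ →
                ∀ f → Cmat P i f ≡ signed γ (cAlong P γ i f)
  Cmat≡signed {P} {i} true  (against≡0 , _) f rewrite against≡0 f = ZP.+-identityʳ (+ c⁺ P i f)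
  Cmat≡signed {P} {i} false (against≡0 , _) f rewrite against≡0 f = ZP.+-identityˡ (ℤ.- (+ c⁻ P i f))

  Bmat≡signed : ∀ {P : IceQuiver n m} → IsQuiver (arr P) → ∀ β {i j} → Arrow P β i j →
                Bmat P i j ≡ signed β (#Arrow P β i j)
  Bmat≡signed {P} isQuiver true  {i} {j} i→j
    rewrite QuiverFacts.q-reverse≡0 isQuiver i→j = ZP.+-identityʳ (+ q P i j)
  Bmat≡signed {P} isQuiver false {i} {j} j→i
    rewrite QuiverFacts.q-reverse≡0 isQuiver j→i = ZP.+-identityˡ (ℤ.- (+ q P j i))

  module _ {P : IceQuiver n m} {i : Fin n} where

    green-if-hasSign : HasSign P i true → Green (Cmat P i)
    green-if-hasSign sign@(_ , ¬along≡0) =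
      (λ f → subst (0ℤ ℤ.≤_) (sym (c≡ f)) (+≤+ z≤n)) ,
      (λ c≡0 → ¬along≡0 (λ f → ZP.+-injective (trans (sym (c≡ f)) (c≡0 f))))
      where
      c≡ : ∀ f → Cmat P i f ≡ + c⁺ P i f
      c≡ = Cmat≡signed {P} {i} true sign

    red-if-hasSign : HasSign P i false → Red (Cmat P i)
    red-if-hasSign sign@(_ , ¬along≡0) =
      (λ f → subst (ℤ._≤ 0ℤ) (sym (c≡ f)) ZP.neg-≤-pos) ,
      (λ c≡0 → ¬along≡0 (λ f → ZP.+-injective (ZP.neg-injective (trans (sym (c≡ f)) (c≡0 f)))))
      where
      c≡ : ∀ f → Cmat P i f ≡ ℤ.- (+ c⁻ P i f)
      c≡ = Cmat≡signed {P} {i} false sign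

    redOrGreen-if-hasSign : ∀ γ → HasSign P i γ → RedOrGreen (Cmat P i)
    redOrGreen-if-hasSign true  = inj₂ ∘ green-if-hasSign
    redOrGreen-if-hasSign false = inj₁ ∘ red-if-hasSign

    sgn≡sign : ∀ γ → HasSign P i γ → sgn (Cmat P i) ≡ sign γ
    sgn≡sign true  = sgn-green (Cmat P i) ∘ green-if-hasSign
    sgn≡sign false = sgn-red (Cmat P i) ∘ red-if-hasSign

    isGreen : RedOrGreen (Cmat P i) → Bool
    isGreen (inj₁ _) = false
    isGreen (inj₂ _) = true

    module _ (isQuiver : IsQuiver (arr P)) where
      open QuiverFacts {P = P} isQuiver using (c-no2Cycle)

      hasSign-if-green : Green (Cmat P i) → HasSign P i true
      hasSign-if-green (c≥0 , c≢0) = c⁻≡0 , λ c⁺≡0 → c≢0 λ f →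
        trans (cong (λ x → + x ℤ.- + c⁻ P i f) (c⁺≡0 f)) (cong (λ x → + 0 ℤ.- + x) (c⁻≡0 f))
        where
        c⁻≡0 : ∀ f → c⁻ P i f ≡ 0
        c⁻≡0 f with c-no2Cycle i f
        ... | inj₂ c⁻≡0 = c⁻≡0
        ... | inj₁ c⁺≡0 = n≤0⇒n≡0 (ZP.drop‿+≤+ (ZP.neg-cancel-≤ (subst (0ℤ ℤ.≤_) c≡-c⁻ (c≥0 f))))
          where
          c≡-c⁻ : Cmat P i f ≡ ℤ.- (+ c⁻ P i f)
          c≡-c⁻ = trans (cong (λ x → + x ℤ.- + c⁻ P i f) c⁺≡0) (ZP.+-identityˡ (ℤ.- (+ c⁻ P i f)))

      hasSign-if-red : Red (Cmat P i) → HasSign P i false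
      hasSign-if-red (c≤0 , c≢0) = c⁺≡0 , λ c⁻≡0 → c≢0 λ f →
        trans (cong (λ x → + c⁺ P i f ℤ.- + x) (c⁻≡0 f)) (cong (λ x → + x ℤ.- + 0) (c⁺≡0 f))
        where
        c⁺≡0 : ∀ f → c⁺ P i f ≡ 0
        c⁺≡0 f with c-no2Cycle i f
        ... | inj₁ c⁺≡0 = c⁺≡0
        ... | inj₂ c⁻≡0 = n≤0⇒n≡0 (ZP.drop‿+≤+ (subst (ℤ._≤ 0ℤ) c≡c⁺ (c≤0 f)))
          where
          c≡c⁺ : Cmat P i f ≡ + c⁺ P i f
          c≡c⁺ = trans (cong (λ x → + c⁺ P i f ℤ.- + x) c⁻≡0) (ZP.+-identityʳ (+ c⁺ P i f))

      hasSign-if-redOrGreen : (rg : RedOrGreen (Cmat P i)) → HasSign P i (isGreen rg)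
      hasSign-if-redOrGreen (inj₁ red)   = hasSign-if-red red
      hasSign-if-redOrGreen (inj₂ green) = hasSign-if-green green

  B*C≥0 : ∀ {P : IceQuiver n m} → IsQuiver (arr P) → ∀ β {i j} → Arrow P β i j → HasSign P j β →
          0v ≤v (Bmat P i j · Cmat P j)
  B*C≥0 {P} isQuiver β {i} {j} i→j j-sign f
    rewrite Bmat≡signed isQuiver β i→j | Cmat≡signed {P} {j} β j-sign f = signed*signed≥0 β _ _

  B*C≤0 : ∀ {P : IceQuiver n m} → IsQuiver (arr P) → ∀ β {i j} → Arrow P β i j → HasSign P j (not β) →
          (Bmat P i j · Cmat P j) ≤v 0v
  B*C≤0 {P} isQuiver β {i} {j} i→j j-sign f
    rewrite Bmat≡signed isQuiver β i→j | Cmat≡signed {P} {j} (not β) j-sign f = signed*signed-not≤0 β _ _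

  signPattern-from-hypotheses : ∀ (Q : IceQuiver n m) v → Fork (μ v Q) (just v) →
                                CondA Q v → CondB Q v → CondC Q v → CondD Q v → ∃ (SignPattern (μ v Q) v)
  signPattern-from-hypotheses Q v F condA condB condC condD = s , record
    { hasSign = hasSign ; condB = condB′ ; condC = condC′ ; condD = condD′ }
    where
    P : IceQuiver n m
    P = μ v Q
    open Fork F
    open ForkFacts F
    s : Fin n → Bool
    s i = isGreen {P = P} {i = i} (condA i)
    hasSign : ∀ i → HasSign P i (s i)
    hasSign i = hasSign-if-redOrGreen {P = P} {i = i} isQuiver (condA i)
    sgn≡ : ∀ i → sgn (Cmat P i) ≡ sign (s i)
    sgn≡ i = sgn≡sign {P = P} {i = i} (s i) (hasSign i)
    sign-injective′ : ∀ {i j} → sgn (Cmat P i) ≡ sgn (Cmat P j) → s i ≡ s j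
    sign-injective′ {i} {j} sgn-i≡sgn-j = sign-injective (trans (sym (sgn≡ i)) (trans sgn-i≡sgn-j (sgn≡ j)))

    condC′ : ∀ j → j ≢ v → s j ≡ s v → Arrow P (s v) v j
    condC′ j j≢v sj≡sv with Arrow? P (s v) v j
    ... | yes v→j = v→j
    ... | no v↛j  = ⊥-elim (BP.not-¬ sj≡sv (sign-injective (begin
      sign (s j)          ≡⟨ sgn≡ j ⟨
      sgn (Cmat P j)      ≡⟨ condC j j≢v (B*C≤0 {P = P} isQuiver (not (s v)) v→j sj≡¬¬sv) ⟩
      ℤ.- sgn (Cmat P v)  ≡⟨ cong ℤ.-_ (sgn≡ v) ⟩
      ℤ.- sign (s v)      ≡⟨ -sign≡sign-not (s v) ⟩
      sign (not (s v))    ∎)))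
      where
      open ≡-Reasoning
      v→j : Arrow P (not (s v)) v j
      v→j = [ ⊥-elim ∘ v↛j , id ]′ (Arrow-connex (s v) (j≢v ∘ sym))
      sj≡¬¬sv : HasSign P j (not (not (s v)))
      sj≡¬¬sv = subst (HasSign P j) (trans sj≡sv (sym (BP.not-involutive (s v)))) (hasSign j)

    condD′ : ∀ i j → i ≢ v → j ≢ v → s i ≢ s j → Arrow P (s i) i j
    condD′ i j i≢v j≢v si≢sj with Arrow? P (s i) i j
    ... | yes i→j = i→j
    ... | no i↛j  = ⊥-elim (si≢sj (sign-injective′ (condD i j i≢j i≢v j≢v Bc≥0)))
      where
      i≢j : i ≢ j
      i≢j i≡j = si≢sj (cong s i≡j)
      Bc≥0 : 0v ≤v (Bmat P i j · Cmat P j)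
      Bc≥0 = B*C≥0 {P = P} isQuiver (not (s i)) ([ ⊥-elim ∘ i↛j , id ]′ (Arrow-connex (s i) i≢j))
                   (subst (HasSign P j) (BP.¬-not (si≢sj ∘ sym)) (hasSign j))

    condB′ : ∀ j → j ≢ v → Arrow P (s j) v j → s j ≢ s v → ∀ f → |c| P v f ≤ |c| P j f
    condB′ j j≢v v→j sj≢sv f with condB j j≢v (B*C≥0 {P = P} isQuiver (s j) v→j (hasSign j))
    ... | inj₁ sgn-j≡sgn-v = ⊥-elim (sj≢sv (sign-injective′ sgn-j≡sgn-v))
    ... | inj₂ |cv|≤|cj|   =
      subst₂ _≤_ (sym (|c|≡cAlong (s v) (hasSign v) f)) (sym (|c|≡cAlong (s j) (hasSign j) f))
                 (ZP.drop‿+≤+ (subst₂ ℤ._≤_ (sgn*c≡ v) (sgn*c≡ j) (|cv|≤|cj| f)))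
      where
      sgn*c≡ : ∀ k → sgn (Cmat P k) ℤ.* Cmat P k f ≡ + cAlong P (s k) k f
      sgn*c≡ k = trans (cong₂ ℤ._*_ (sgn≡ k) (Cmat≡signed {P} {k} (s k) (hasSign k) f))
                       (sign*signed (s k) _)

  _≈_ : IceQuiver n m → IceQuiver n m → Set
  P ≈ P′ = ∀ a b → arr P a b ≡ arr P′ a b

  μ-cong : ∀ k {P P′ : IceQuiver n m} → P ≈ P′ → μ k P ≈ μ k P′
  μ-cong k = mutateQ-cong (mut m k)

  hasSign-≈ : ∀ {P P′ : IceQuiver n m} {i} β → P ≈ P′ → HasSign P′ i β → HasSign P i β
  hasSign-≈ {P} {P′} {i} β P≈P′ =
    hasSign-sameRow {P = P′} {P′ = P} {i = i} {j = i} β (λ _ → P≈P′ _ _ , P≈P′ _ _)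

  -- Mutation sequences from Q without immediate repetitions; by involutivity every mutation
  -- sequence reduces to one of these.
  module Reduction (Q : IceQuiver n m) (isQuiver : IsQuiver (arr Q))
                   (start : ∀ v → Admissible (μ v Q) v) where

    data Reduced : IceQuiver n m → Set where
      base : Reduced Q
      push : ∀ {P} u → Reduced P → Admissible (μ u P) u → Reduced (μ u P)

    reduced-isQuiver : ∀ {P} → Reduced P → IsQuiver (arr P)
    reduced-isQuiver base           = isQuiver
    reduced-isQuiver (push _ _ adm) = Fork.isQuiver (proj₁ adm)

    reduced-μ : ∀ {P} → Reduced P → ∀ k → Σ (IceQuiver n m) λ P′ → Reduced P′ × μ k P ≈ P′
    reduced-μ base k = μ k Q , push k base (start k) , λ _ _ → refl
    reduced-μ (push {P} u r adm) k with u F.≟ k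
    ... | yes refl = P , r , mutateQ-involutive (mut m u) (arr P) (reduced-isQuiver r)
    ... | no u≢k   = μ k (μ u P) , push k (push u r adm) (admissible-μ adm k (u≢k ∘ sym)) , λ _ _ → refl

    reduced-hasSign : ∀ {P} → Reduced P → ∀ i → ∃ (HasSign P i)
    reduced-hasSign base i =
      let (_ , s , S) = start i in not (s i) , hasSign-μ-self⁻¹ (s i) (SignPattern.hasSign S i)
    reduced-hasSign (push _ _ (_ , s , S)) i = s i , SignPattern.hasSign S i

    hasSign-μs : ∀ ks {P P₀} → Reduced P₀ → P ≈ P₀ → ∀ i → ∃ (HasSign (μs ks P) i)
    hasSign-μs [] r P≈P₀ i = let (β , sign) = reduced-hasSign r i in β , hasSign-≈ {i = i} β P≈P₀ sign
    hasSign-μs (k ∷ ks) r P≈P₀ i =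
      let (P₁ , r₁ , μkP₀≈P₁) = reduced-μ r k
      in hasSign-μs ks r₁ (λ a b → trans (μ-cong k P≈P₀ a b) (μkP₀≈P₁ a b)) i

    strictlySignCoherent : StrictlySignCoherent Q
    strictlySignCoherent ks i =
      let (β , sign) = hasSign-μs ks base (λ _ _ → refl) i in redOrGreen-if-hasSign β sign

  fork-if-acyclic : ∀ {P : IceQuiver n m} → IsQuiver (arr P) → Abundant (q P) → Acyclic (q P) →
                    Fork P nothing
  fork-if-acyclic isQuiver abundant acyclic = record
    { isQuiver   = isQuiver
    ; abundant   = abundant
    ; noTriangle = λ a b c _ _ _ a→b b→c c→a →
        acyclic a (step (n>0⇒n≢0 a→b) (step (n>0⇒n≢0 b→c) (edge (n>0⇒n≢0 c→a))))
    ; returns    = tt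
    }

  admissible-from-hypotheses : ∀ {Q : IceQuiver n m} → Fork Q nothing →
                               (∀ v → CondA Q v × CondB Q v × CondC Q v × CondD Q v) →
                               ∀ v → Admissible (μ v Q) v
  admissible-from-hypotheses {Q} F conds v =
    let (condA , condB , condC , condD) = conds v
    in fork-μ F v tt , signPattern-from-hypotheses Q v (fork-μ F v tt) condA condB condC condD

  admissible-if-uniformSign : ∀ {P : IceQuiver n m} → Fork P nothing → ∀ β → (∀ i → HasSign P i β) →
                              ∀ v → Admissible (μ v P) v
  admissible-if-uniformSign {P} F β sign v = fork-μ F v tt , s , record
    { hasSign = hasSign′ ; condB = condB′ ; condC = condC′ ; condD = condD′ }
    where
    open SignMutation (Fork.isQuiver F) v using (P′; hasSign-μ-same; |c|-μ-self)
    s : Fin n → Bool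
    s j = [ const (not β) , const β ]′ (≡⊎≢ j v)
    s-v : s v ≡ not β
    s-v with ≡⊎≢ v v
    ... | inj₁ _   = refl
    ... | inj₂ v≢v = ⊥-elim (v≢v refl)
    s-other : ∀ {j} → j ≢ v → s j ≡ β
    s-other {j} j≢v with ≡⊎≢ j v
    ... | inj₁ j≡v = ⊥-elim (j≢v j≡v)
    ... | inj₂ _   = refl
    hasSign′ : ∀ i → HasSign P′ i (s i)
    hasSign′ i with ≡⊎≢ i v
    ... | inj₁ refl = hasSign-μ-self β (sign v)
    ... | inj₂ i≢v  = proj₁ (hasSign-μ-same β i≢v (sign v) (sign i))
    condB′ : ∀ j → j ≢ v → Arrow P′ (s j) v j → s j ≢ s v → ∀ f → |c| P′ v f ≤ |c| P′ j f
    condB′ j j≢v v→j _ f =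
      subst (_≤ |c| P′ j f) (sym (|c|-μ-self f)) (proj₂ (hasSign-μ-same β j≢v (sign v) (sign j)) j→v f)
      where
      j→v : Arrow P β j v
      j→v = subst (0 <_) (#Arrow-μ-from P v β j) (subst (λ b → Arrow P′ b v j) (s-other j≢v) v→j)
    condC′ : ∀ j → j ≢ v → s j ≡ s v → Arrow P′ (s v) v j
    condC′ j j≢v sj≡sv = ⊥-elim (BP.not-¬ refl (trans (sym (s-other j≢v)) (trans sj≡sv s-v)))
    condD′ : ∀ i j → i ≢ v → j ≢ v → s i ≢ s j → Arrow P′ (s i) i j
    condD′ i j i≢v j≢v si≢sj = ⊥-elim (si≢sj (trans (s-other i≢v) (sym (s-other j≢v))))

strictlySignCoherent-from-hypotheses :
  ∀ {n m} (Q : IceQuiver n m) → IsQuiver (arr Q) → Abundant (mutablePart Q) → Acyclic (mutablePart Q) →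
  (∀ v → CondA Q v × CondB Q v × CondC Q v × CondD Q v) → StrictlySignCoherent Q
strictlySignCoherent-from-hypotheses Q isQ abundant acyclic conds =
  Reduction.strictlySignCoherent Q isQ
    (admissible-from-hypotheses (fork-if-acyclic isQ abundant acyclic) conds)

strictlySignCoherent-if-uniformSign : ∀ {n m} {P : IceQuiver n m} → Fork P nothing →
                                      ∀ β → (∀ i → HasSign P i β) → StrictlySignCoherent P
strictlySignCoherent-if-uniformSign {P = P} F β sign =
  Reduction.strictlySignCoherent P (Fork.isQuiver F) (admissible-if-uniformSign F β sign)

path-cong : ∀ {N} {Q Q′ : Quiver N} → (∀ a b → Q a b ≡ Q′ a b) → ∀ {a b} → Path Q a b → Path Q′ a b
path-cong Q≗Q′ (edge a→b)   = edge (λ e → a→b (trans (Q≗Q′ _ _) e))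
path-cong Q≗Q′ (step a→b p) = step (λ e → a→b (trans (Q≗Q′ _ _) e)) (path-cong Q≗Q′ p)

acyclic-cong : ∀ {N} {Q Q′ : Quiver N} → (∀ a b → Q a b ≡ Q′ a b) → Acyclic Q′ → Acyclic Q
acyclic-cong Q≗Q′ acyclic a = acyclic a ∘ path-cong Q≗Q′

abundant-cong : ∀ {N} {Q Q′ : Quiver N} → (∀ a b → Q a b ≡ Q′ a b) → Abundant Q′ → Abundant Q
abundant-cong Q≗Q′ abundant a b a≢b =
  subst (2 ≤_) (sym (cong₂ _+_ (Q≗Q′ a b) (Q≗Q′ b a))) (abundant a b a≢b)

module _ {n : ℕ} (Q : Quiver n) where

  framing-isQuiver : IsQuiver Q → IsQuiver (arr (framing Q))
  framing-isQuiver isQ = noLoop , no2Cycle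
    where
    noLoop : ∀ a → arr (framing Q) a a ≡ 0
    noLoop a with splitAt n a
    ... | inj₁ i = proj₁ isQ i
    ... | inj₂ _ = refl
    no2Cycle : ∀ a b → arr (framing Q) a b ≡ 0 ⊎ arr (framing Q) b a ≡ 0
    no2Cycle a b with splitAt n a | splitAt n b
    ... | inj₁ i | inj₁ j = proj₂ isQ i j
    ... | inj₁ _ | inj₂ _ = inj₂ refl
    ... | inj₂ _ | _      = inj₁ refl

  coframing-isQuiver : IsQuiver Q → IsQuiver (arr (coframing Q))
  coframing-isQuiver isQ = noLoop , no2Cycle
    where
    noLoop : ∀ a → arr (coframing Q) a a ≡ 0
    noLoop a with splitAt n a
    ... | inj₁ i = proj₁ isQ i
    ... | inj₂ _ = refl
    no2Cycle : ∀ a b → arr (coframing Q) a b ≡ 0 ⊎ arr (coframing Q) b a ≡ 0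
    no2Cycle a b with splitAt n a | splitAt n b
    ... | inj₁ i | inj₁ j = proj₂ isQ i j
    ... | inj₂ _ | inj₁ _ = inj₂ refl
    ... | inj₁ _ | inj₂ _ = inj₁ refl
    ... | inj₂ _ | inj₂ _ = inj₁ refl

  framing-mutablePart : ∀ i j → q (framing Q) i j ≡ Q i j
  framing-mutablePart i j rewrite splitAt-↑ˡ n i n | splitAt-↑ˡ n j n = refl

  coframing-mutablePart : ∀ i j → q (coframing Q) i j ≡ Q i j
  coframing-mutablePart i j rewrite splitAt-↑ˡ n i n | splitAt-↑ˡ n j n = refl

  framing-green : ∀ i → HasSign (framing Q) i true
  framing-green i = c⁻≡0 , λ c⁺≡0 → 1+n≢0 (trans (sym c⁺ii≡1) (c⁺≡0 i))
    where
    c⁻≡0 : ∀ f → c⁻ (framing Q) i f ≡ 0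
    c⁻≡0 f rewrite splitAt-↑ʳ n n f = refl
    c⁺ii≡1 : c⁺ (framing Q) i i ≡ 1
    c⁺ii≡1 rewrite splitAt-↑ˡ n i n | splitAt-↑ʳ n n i | dec-true (i F.≟ i) refl = refl

  coframing-red : ∀ i → HasSign (coframing Q) i false
  coframing-red i = c⁺≡0 , λ c⁻≡0 → 1+n≢0 (trans (sym c⁻ii≡1) (c⁻≡0 i))
    where
    c⁺≡0 : ∀ f → c⁺ (coframing Q) i f ≡ 0
    c⁺≡0 f rewrite splitAt-↑ˡ n i n | splitAt-↑ʳ n n f = refl
    c⁻ii≡1 : c⁻ (coframing Q) i i ≡ 1
    c⁻ii≡1 rewrite splitAt-↑ˡ n i n | splitAt-↑ʳ n n i | dec-true (i F.≟ i) refl = refl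

  framing-strictlySignCoherent : IsQuiver Q → Abundant Q → Acyclic Q → StrictlySignCoherent (framing Q)
  framing-strictlySignCoherent isQ abundant acyclic =
    strictlySignCoherent-if-uniformSign
      (fork-if-acyclic (framing-isQuiver isQ) (abundant-cong framing-mutablePart abundant)
                       (acyclic-cong framing-mutablePart acyclic))
      true framing-green

  coframing-strictlySignCoherent : IsQuiver Q → Abundant Q → Acyclic Q → StrictlySignCoherent (coframing Q)
  coframing-strictlySignCoherent isQ abundant acyclic =
    strictlySignCoherent-if-uniformSign
      (fork-if-acyclic (coframing-isQuiver isQ) (abundant-cong coframing-mutablePart abundant)
                       (acyclic-cong coframing-mutablePart acyclic))
      false coframing-red

corollary5p6 :
    ((n m : ℕ) (Q : IceQuiver n m) → IsQuiver (arr Q) →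
      Abundant (mutablePart Q) → Acyclic (mutablePart Q) →
      ((v : Fin n) → CondA Q v × CondB Q v × CondC Q v × CondD Q v) →
      StrictlySignCoherent Q)
    ×
    ((n : ℕ) (Q : Quiver n) → IsQuiver Q → Abundant Q → Acyclic Q →
      StrictlySignCoherent (framing Q) × StrictlySignCoherent (coframing Q))
corollary5p6 =
  (λ _ _ → strictlySignCoherent-from-hypotheses) ,
  (λ _ Q isQ abundant acyclic → framing-strictlySignCoherent Q isQ abundant acyclic ,
                                coframing-strictlySignCoherent Q isQ abundant acyclic)
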